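{- Let $F_n$ and $L_n$ denote the Fibonacci and Lucas numbers ($F_0=0$, $F_1=1$, $L_0=2$, $L_1=1$, and $F_n=F_{n-1}+F_{n-2}$, $L_n=L_{n-1}+L_{n-2}$ for $n\ge 2$). For every positive integer $m$ there exists a polynomial $P_{2m-1}(x)$ of degree $2m-1$ with integer coefficients such that for every positive integer $n$, \[ L_1L_3L_5\cdots L_{2m+1}\sum_{k=1}^n F_{2k}^{2m+1}=(F_{2n+1}-1)^2P_{2m-1}(F_{2n+1}). \]
   Context: This is Melham's conjecture, which the paper proves. -}

module Defs where

open import Data.Nat using (ℕ; zero; suc)
import Data.Nat as N
open import Data.Integer using (ℤ; +_; _+_; _*_; _-_; _^_)
open import Data.List using (List; []; _∷_; length; last)
open import Data.Maybe using (Maybe; just; nothing)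
open import Relation.Binary.PropositionalEquality using (_≡_)
open import Relation.Nullary using (¬_)
open import Data.Product using (_×_; ∃)

fib : ℕ → ℕ
fib zero = zero
fib (suc zero) = suc zero
fib (suc (suc n)) = fib (suc n) N.+ fib n

lucas : ℕ → ℕ
lucas zero = 2
lucas (suc zero) = 1
lucas (suc (suc n)) = lucas (suc n) N.+ lucas n

-- Polynomials with integer coefficients: coefficient lists, constant term first.
Poly : Set
Poly = List ℤ

eval : Poly → ℤ → ℤ
eval [] x = + 0
eval (c ∷ cs) x = c + x * eval cs x

HasDegree : Poly → ℕ → Set
HasDegree p d = (length p ≡ suc d) × ∃ λ c → (last p ≡ just c) × ¬ (c ≡ + 0)

lucasOddProd : ℕ → ℤ
lucasOddProd zero = + lucas 1
lucasOddProd (suc j) = lucasOddProd j * + lucas (2 N.* suc j N.+ 1)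

sumFibEvenPow : ℕ → ℕ → ℤ
sumFibEvenPow e zero = + 0
sumFibEvenPow e (suc n) = sumFibEvenPow e n + (+ fib (2 N.* suc n)) ^ e

-- Put x = F_{2n+1}, x′ = F_{2n-1} and y = F_{2n}.  Then x - x′ = y and, by Cassini,
-- x x′ = y² + 1; under these two relations x^{2j+1} - x′^{2j+1} = y W_j(y²) for an integer
-- polynomial W_j of degree j with leading coefficient L_{2j+1}.  Triangular elimination
-- writes L_1 L_3 ⋯ L_{2m+1} s^m = Σ_j g_j W_j(s) with integers g_j, so with the odd
-- polynomial G(x) = Σ_j g_j x^{2j+1} each term L_1 ⋯ L_{2m+1} F_{2k}^{2m+1} equals
-- G(F_{2k+1}) - G(F_{2k-1}) and the sum telescopes to G(F_{2n+1}) - G(1).  Setting s = 0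
-- gives G′(1) = Σ_j (2j+1) g_j = Σ_j g_j W_j(0) = 0, so (x - 1)² divides G(x) - G(1); the
-- quotient has degree 2m-1 and leading coefficient g_m = L_1 L_3 ⋯ L_{2m-1} ≠ 0.
module Submission where

open import Defs
open import Data.Nat using (ℕ; zero; suc; _∸_; _≤′_; ≤′-refl; ≤′-step)
import Data.Nat as N
import Data.Nat.Properties as ℕ
import Data.Nat.Tactic.RingSolver as ℕ-Solver
open import Data.Integer using (ℤ; +_; -_; _+_; _*_; _-_; _^_)
import Data.Integer.Properties as ℤ
open import Data.Integer.Tactic.RingSolver using (solve-∀)
open import Data.List using (last)
open import Data.Maybe using (just)
open import Data.Product using (Σ; _×_; _,_; proj₁; proj₂; ∃)
open import Data.Vec using (Vec; []; _∷_; _∷ʳ_; toList; zipWith; map; initLast)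
open import Data.Vec.Properties using (length-toList)
open import Function using (_∘_; case_of_)
open import Relation.Binary.PropositionalEquality
  using (_≡_; refl; sym; trans; cong; cong₂; subst₂; module ≡-Reasoning)
open import Relation.Nullary using (¬_)

open ≡-Reasoning

combine : ∀ {k} → Vec ℤ k → (ℕ → ℤ) → ℤ
combine []      u = + 0
combine (a ∷ g) u = a * u 0 + combine g (u ∘ suc)

combine-cong : ∀ {k} (g : Vec ℤ k) {u w : ℕ → ℤ} → (∀ j → u j ≡ w j) →
               combine g u ≡ combine g w
combine-cong []      u≗w = refl
combine-cong (a ∷ g) u≗w = cong₂ (λ s t → a * s + t) (u≗w 0) (combine-cong g (u≗w ∘ suc))

combine-*ˡ : ∀ {k} (g : Vec ℤ k) c u → combine g (λ j → c * u j) ≡ c * combine g u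
combine-*ˡ []      c u = sym (ℤ.*-zeroʳ c)
combine-*ˡ (a ∷ g) c u = begin
  a * (c * u 0) + combine g (λ j → c * u (suc j)) ≡⟨ cong (λ t → a * (c * u 0) + t) (combine-*ˡ g c (u ∘ suc)) ⟩
  a * (c * u 0) + c * combine g (u ∘ suc)         ≡⟨ factor a c (u 0) _ ⟩
  c * (a * u 0 + combine g (u ∘ suc)) ∎
  where
  factor : ∀ a c x y → a * (c * x) + c * y ≡ c * (a * x + y)
  factor = solve-∀

combine-- : ∀ {k} (g : Vec ℤ k) u w → combine g (λ j → u j - w j) ≡ combine g u - combine g w
combine-- []      u w = refl
combine-- (a ∷ g) u w = begin
  a * (u 0 - w 0) + combine g (λ j → u (suc j) - w (suc j))
    ≡⟨ cong (λ t → a * (u 0 - w 0) + t) (combine-- g (u ∘ suc) (w ∘ suc)) ⟩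
  a * (u 0 - w 0) + (combine g (u ∘ suc) - combine g (w ∘ suc))
    ≡⟨ regroup a (u 0) (w 0) _ _ ⟩
  (a * u 0 + combine g (u ∘ suc)) - (a * w 0 + combine g (w ∘ suc)) ∎
  where
  regroup : ∀ a x y s t → a * (x - y) + (s - t) ≡ (a * x + s) - (a * y + t)
  regroup = solve-∀

combine-∷ʳ : ∀ {k} (g : Vec ℤ k) a u → combine (g ∷ʳ a) u ≡ combine g u + a * u k
combine-∷ʳ []      a u = trans (ℤ.+-identityʳ (a * u 0)) (sym (ℤ.+-identityˡ (a * u 0)))
combine-∷ʳ (b ∷ g) a u = begin
  b * u 0 + combine (g ∷ʳ a) (u ∘ suc)   ≡⟨ cong (λ t → b * u 0 + t) (combine-∷ʳ g a (u ∘ suc)) ⟩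
  b * u 0 + (combine g (u ∘ suc) + a * _) ≡⟨ sym (ℤ.+-assoc (b * u 0) _ _) ⟩
  b * u 0 + combine g (u ∘ suc) + a * _ ∎

eval-zipWith-+ : ∀ {k} (v w : Vec ℤ k) x →
                 eval (toList (zipWith _+_ v w)) x ≡ eval (toList v) x + eval (toList w) x
eval-zipWith-+ []      []      x = refl
eval-zipWith-+ (a ∷ v) (b ∷ w) x = begin
  (a + b) + x * eval (toList (zipWith _+_ v w)) x
    ≡⟨ cong (λ t → (a + b) + x * t) (eval-zipWith-+ v w x) ⟩
  (a + b) + x * (eval (toList v) x + eval (toList w) x)
    ≡⟨ regroup a b x _ _ ⟩
  (a + x * eval (toList v) x) + (b + x * eval (toList w) x) ∎
  where
  regroup : ∀ a b x s t → (a + b) + x * (s + t) ≡ (a + x * s) + (b + x * t)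
  regroup = solve-∀

eval-map-* : ∀ {k} c (v : Vec ℤ k) x → eval (toList (map (c *_) v)) x ≡ c * eval (toList v) x
eval-map-* c []      x = sym (ℤ.*-zeroʳ c)
eval-map-* c (a ∷ v) x = begin
  c * a + x * eval (toList (map (c *_) v)) x ≡⟨ cong (λ t → c * a + x * t) (eval-map-* c v x) ⟩
  c * a + x * (c * eval (toList v) x)       ≡⟨ factor c a x _ ⟩
  c * (a + x * eval (toList v) x) ∎
  where
  factor : ∀ c a x s → c * a + x * (c * s) ≡ c * (a + x * s)
  factor = solve-∀

eval-∷ʳ : ∀ {k} (v : Vec ℤ k) a x → eval (toList (v ∷ʳ a)) x ≡ eval (toList v) x + a * x ^ k
eval-∷ʳ []      a x = constant a x
  where
  constant : ∀ a x → a + x * + 0 ≡ + 0 + a * + 1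
  constant = solve-∀
eval-∷ʳ {suc k} (b ∷ v) a x = begin
  b + x * eval (toList (v ∷ʳ a)) x       ≡⟨ cong (λ t → b + x * t) (eval-∷ʳ v a x) ⟩
  b + x * (eval (toList v) x + a * x ^ k) ≡⟨ regroup b x _ a (x ^ k) ⟩
  (b + x * eval (toList v) x) + a * (x * x ^ k) ∎
  where
  regroup : ∀ b x s a p → b + x * (s + a * p) ≡ (b + x * s) + a * (x * p)
  regroup = solve-∀

last-toList-∷ʳ : ∀ {k} (v : Vec ℤ k) c → last (toList (v ∷ʳ c)) ≡ just c
last-toList-∷ʳ []          c = refl
last-toList-∷ʳ (a ∷ [])    c = refl
last-toList-∷ʳ (a ∷ b ∷ v) c = last-toList-∷ʳ (b ∷ v) c

DegreeBelow : ℕ → (ℤ → ℤ) → Set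
DegreeBelow k f = Σ (Vec ℤ k) λ v → ∀ x → f x ≡ eval (toList v) x

-- Leading and Recurrence are records rather than synonyms so that their indices can be
-- inferred by unification.
record Leading (k : ℕ) (c : ℤ) (f : ℤ → ℤ) : Set where
  constructor leading
  field lowerTerms : DegreeBelow k (λ x → f x - c * x ^ k)

open Leading using (lowerTerms)

degreeBelow-cong : ∀ {k f g} → (∀ x → f x ≡ g x) → DegreeBelow k f → DegreeBelow k g
degreeBelow-cong f≗g (v , hv) = v , λ x → trans (sym (f≗g x)) (hv x)

degreeBelow-+ : ∀ {k f g} → DegreeBelow k f → DegreeBelow k g → DegreeBelow k (λ x → f x + g x)
degreeBelow-+ (v , hv) (w , hw) =
  zipWith _+_ v w , λ x → trans (cong₂ _+_ (hv x) (hw x)) (sym (eval-zipWith-+ v w x))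

degreeBelow-* : ∀ {k} c {f} → DegreeBelow k f → DegreeBelow k (λ x → c * f x)
degreeBelow-* c (v , hv) = map (c *_) v , λ x → trans (cong (c *_) (hv x)) (sym (eval-map-* c v x))

degreeBelow-- : ∀ {k f g} → DegreeBelow k f → DegreeBelow k g → DegreeBelow k (λ x → f x - g x)
degreeBelow-- {f = f} {g} df dg =
  degreeBelow-cong (λ x → cong (_+_ (f x)) (ℤ.-1*i≡-i (g x))) (degreeBelow-+ df (degreeBelow-* (- + 1) dg))

degreeBelow-horner : ∀ {k} c {f} → DegreeBelow k f → DegreeBelow (suc k) (λ x → c + x * f x)
degreeBelow-horner c (v , hv) = c ∷ v , λ x → cong (λ t → c + x * t) (hv x)

degreeBelow-x : ∀ {k f} → DegreeBelow k f → DegreeBelow (suc k) (λ x → x * f x)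
degreeBelow-x df = degreeBelow-cong (λ x → ℤ.+-identityˡ _) (degreeBelow-horner (+ 0) df)

degreeBelow-suc : ∀ {k f} → DegreeBelow k f → DegreeBelow (suc k) f
degreeBelow-suc (v , hv) = v ∷ʳ + 0 , λ x → trans (hv x) (sym (trans (eval-∷ʳ v (+ 0) x) (ℤ.+-identityʳ _)))

leading⇒degreeBelow : ∀ {k c f} → Leading k c f → DegreeBelow (suc k) f
leading⇒degreeBelow {k} {c} {f} (leading (v , hv)) = v ∷ʳ c , λ x → begin
  f x                                 ≡⟨ split (f x) (c * x ^ k) ⟩
  (f x - c * x ^ k) + c * x ^ k       ≡⟨ cong (_+ c * x ^ k) (hv x) ⟩
  eval (toList v) x + c * x ^ k       ≡⟨ sym (eval-∷ʳ v c x) ⟩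
  eval (toList (v ∷ʳ c)) x ∎
  where
  split : ∀ a b → a ≡ (a - b) + b
  split = solve-∀

degreeBelow⇒leading : ∀ {k f} → DegreeBelow (suc k) f → ∃ λ c → Leading k c f
degreeBelow⇒leading {k} {f} (v , hv) with initLast v
... | w , c , refl = c , leading (w , λ x → begin
  f x - c * x ^ k                                   ≡⟨ cong (_- c * x ^ k) (hv x) ⟩
  eval (toList (w ∷ʳ c)) x - c * x ^ k              ≡⟨ cong (_- c * x ^ k) (eval-∷ʳ w c x) ⟩
  eval (toList w) x + c * x ^ k - c * x ^ k         ≡⟨ cancel (eval (toList w) x) (c * x ^ k) ⟩
  eval (toList w) x ∎)
  where
  cancel : ∀ a b → a + b - b ≡ a
  cancel = solve-∀

leading⇒hasDegree : ∀ {k c f} → Leading k c f → ¬ (c ≡ + 0) →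
                    Σ Poly λ P → HasDegree P k × (∀ x → eval P x ≡ f x)
leading⇒hasDegree {c = c} lf@(leading (v , _)) c≢0 =
  toList (v ∷ʳ c) , (length-toList (v ∷ʳ c) , c , last-toList-∷ʳ v c , c≢0) ,
  λ x → sym (proj₂ (leading⇒degreeBelow lf) x)

degreeBelow-zero : ∀ k → DegreeBelow k (λ _ → + 0)
degreeBelow-zero zero    = [] , λ _ → refl
degreeBelow-zero (suc k) = degreeBelow-cong (λ x → ℤ.*-zeroʳ x) (degreeBelow-x (degreeBelow-zero k))

degreeBelow-mono : ∀ {k n f} → k ≤′ n → DegreeBelow k f → DegreeBelow n f
degreeBelow-mono ≤′-refl       df = df
degreeBelow-mono (≤′-step k≤n) df = degreeBelow-suc (degreeBelow-mono k≤n df)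

degreeBelow-combine : ∀ {k d} (b : ℕ → ℤ → ℤ) → (∀ j → j N.< k → DegreeBelow d (b j)) →
                      (g : Vec ℤ k) → DegreeBelow d (λ x → combine g (λ j → b j x))
degreeBelow-combine {d = d} b db []      = degreeBelow-zero d
degreeBelow-combine         b db (a ∷ g) =
  degreeBelow-+ (degreeBelow-* a (db 0 (N.s≤s N.z≤n)))
                (degreeBelow-combine (b ∘ suc) (λ j j<k → db (suc j) (N.s≤s j<k)) g)

leading-monomial : ∀ k → Leading k (+ 1) (_^ k)
leading-monomial k = leading (degreeBelow-cong (λ x → sym (cancel (x ^ k))) (degreeBelow-zero k))
  where
  cancel : ∀ a → a - + 1 * a ≡ + 0
  cancel = solve-∀

record Recurrence (p q : ℤ) (u : ℕ → ℤ) : Set where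
  constructor recurrence
  field step : ∀ j → u (suc (suc j)) ≡ p * u (suc j) - q * u j

recurrence-unique : ∀ {p q u w} → Recurrence p q u → Recurrence p q w →
                    u 0 ≡ w 0 → u 1 ≡ w 1 → ∀ j → u j ≡ w j
recurrence-unique {p} {q} {u} {w} (recurrence recᵘ) (recurrence recʷ) u₀≡w₀ u₁≡w₁ j = proj₁ (agree j)
  where
  agree : ∀ j → u j ≡ w j × u (suc j) ≡ w (suc j)
  agree zero    = u₀≡w₀ , u₁≡w₁
  agree (suc j) = let eq , eq′ = agree j in eq′ , (begin
    u (suc (suc j))           ≡⟨ recᵘ j ⟩
    p * u (suc j) - q * u j   ≡⟨ cong₂ (λ a b → p * a - q * b) eq′ eq ⟩
    p * w (suc j) - q * w j   ≡⟨ sym (recʷ j) ⟩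
    w (suc (suc j)) ∎)

recurrence-*ˡ : ∀ {p q u} c → Recurrence p q u → Recurrence p q (λ j → c * u j)
recurrence-*ˡ {p} {q} {u} c (recurrence recᵘ) = recurrence λ j → begin
  c * u (suc (suc j))             ≡⟨ cong (c *_) (recᵘ j) ⟩
  c * (p * u (suc j) - q * u j)   ≡⟨ distrib c p q (u (suc j)) (u j) ⟩
  p * (c * u (suc j)) - q * (c * u j) ∎
  where
  distrib : ∀ c p q a b → c * (p * a - q * b) ≡ p * (c * a) - q * (c * b)
  distrib = solve-∀

oddPow : ℕ → ℤ → ℤ
oddPow j x = x * (x * x) ^ j

oddPow-sub-recurrence : ∀ x x′ →
  Recurrence (x * x + x′ * x′) ((x * x′) * (x * x′)) (λ j → oddPow j x - oddPow j x′)
oddPow-sub-recurrence x x′ = recurrence λ j → identity x x′ ((x * x) ^ j) ((x′ * x′) ^ j)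
  where
  identity : ∀ x x′ p p′ →
    x * (x * x * (x * x * p)) - x′ * (x′ * x′ * (x′ * x′ * p′))
      ≡ (x * x + x′ * x′) * (x * (x * x * p) - x′ * (x′ * x′ * p′))
        - x * x′ * (x * x′) * (x * p - x′ * p′)
  identity = solve-∀

-- Chosen so that y W_j(y²) = x^{2j+1} - x′^{2j+1} whenever x = x′ + y and x x′ = y² + 1.
W : ℕ → ℤ → ℤ
W zero          s = + 1
W (suc zero)    s = + 4 * s + + 3
W (suc (suc j)) s = (+ 3 * s + + 2) * W (suc j) s - (s + + 1) * (s + + 1) * W j s

W-recurrence : ∀ s → Recurrence (+ 3 * s + + 2) ((s + + 1) * (s + + 1)) (λ j → W j s)
W-recurrence s = recurrence λ j → refl

oddPow-sub-W : ∀ {x x′ y} → x ≡ x′ + y → x * x′ ≡ y * y + + 1 →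
               ∀ j → y * W j (y * y) ≡ oddPow j x - oddPow j x′
oddPow-sub-W {_} {x′} {y} refl xx′≡ =
  recurrence-unique (recurrence-*ˡ y (W-recurrence s)) oddPow-sub-recurrence′ base₀ base₁
  where
  x = x′ + y
  s = y * y
  sum-of-squares : x * x + x′ * x′ ≡ + 3 * s + + 2
  sum-of-squares = begin
    x * x + x′ * x′         ≡⟨ expand x′ y ⟩
    y * y + + 2 * (x * x′)  ≡⟨ cong (λ t → y * y + + 2 * t) xx′≡ ⟩
    y * y + + 2 * (s + + 1) ≡⟨ collect y ⟩
    + 3 * s + + 2 ∎
    where
    expand : ∀ x′ y → (x′ + y) * (x′ + y) + x′ * x′ ≡ y * y + + 2 * ((x′ + y) * x′)
    expand = solve-∀
    collect : ∀ y → y * y + + 2 * (y * y + + 1) ≡ + 3 * (y * y) + + 2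
    collect = solve-∀
  oddPow-sub-recurrence′ : Recurrence (+ 3 * s + + 2) ((s + + 1) * (s + + 1)) (λ j → oddPow j x - oddPow j x′)
  oddPow-sub-recurrence′ = subst₂ (λ p q → Recurrence p q (λ j → oddPow j x - oddPow j x′))
    sum-of-squares (cong₂ _*_ xx′≡ xx′≡) (oddPow-sub-recurrence x x′)
  base₀ : y * + 1 ≡ x * + 1 - x′ * + 1
  base₀ = difference x′ y
    where
    difference : ∀ x′ y → y * + 1 ≡ (x′ + y) * + 1 - x′ * + 1
    difference = solve-∀
  base₁ : y * (+ 4 * s + + 3) ≡ x * (x * x * + 1) - x′ * (x′ * x′ * + 1)
  base₁ = begin
    y * (+ 4 * s + + 3)               ≡⟨ collect y ⟩
    y * (y * y + + 3 * (s + + 1))     ≡⟨ cong (λ t → y * (y * y + + 3 * t)) (sym xx′≡) ⟩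
    y * (y * y + + 3 * (x * x′))      ≡⟨ cubes x′ y ⟩
    x * (x * x * + 1) - x′ * (x′ * x′ * + 1) ∎
    where
    collect : ∀ y → y * (+ 4 * (y * y) + + 3) ≡ y * (y * y + + 3 * (y * y + + 1))
    collect = solve-∀
    cubes : ∀ x′ y → y * (y * y + + 3 * ((x′ + y) * x′))
                     ≡ (x′ + y) * ((x′ + y) * (x′ + y) * + 1) - x′ * (x′ * x′ * + 1)
    cubes = solve-∀

W-at-zero : ∀ j → W j (+ 0) ≡ + suc (2 N.* j)
W-at-zero j = begin
  W j (+ 0)           ≡⟨ recurrence-unique (W-recurrence (+ 0)) linear refl refl j ⟩
  + 1 + + 2 * + j     ≡⟨ cong (_+_ (+ 1)) (sym (ℤ.pos-* 2 j)) ⟩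
  + suc (2 N.* j) ∎
  where
  linear : Recurrence (+ 2) (+ 1) (λ j → + 1 + + 2 * + j)
  linear = recurrence λ j → identity (+ j)
    where
    identity : ∀ t → + 1 + + 2 * (+ 1 + (+ 1 + t)) ≡ + 2 * (+ 1 + + 2 * (+ 1 + t)) - + 1 * (+ 1 + + 2 * t)
    identity = solve-∀

2*suc : ∀ n → 2 N.* suc n ≡ suc (2 N.* n N.+ 1)
2*suc = ℕ-Solver.solve-∀

2*suc+1 : ∀ n → 2 N.* suc n N.+ 1 ≡ 2 N.+ (2 N.* n N.+ 1)
2*suc+1 = ℕ-Solver.solve-∀

oddLucas : ℕ → ℤ
oddLucas j = + lucas (2 N.* j N.+ 1)

lucas-skip : ∀ k → + lucas (4 N.+ k) ≡ + 3 * + lucas (2 N.+ k) - + lucas k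
lucas-skip k = identity (+ lucas (suc k)) (+ lucas k)
  where
  identity : ∀ a b → a + b + a + (a + b) ≡ + 3 * (a + b) - b
  identity = solve-∀

oddLucas-recurrence : ∀ j → oddLucas (suc (suc j)) ≡ + 3 * oddLucas (suc j) - oddLucas j
oddLucas-recurrence j = begin
  + lucas (2 N.* suc (suc j) N.+ 1)
    ≡⟨ cong (+_ ∘ lucas) (trans (2*suc+1 (suc j)) (cong (2 N.+_) (2*suc+1 j))) ⟩
  + lucas (4 N.+ (2 N.* j N.+ 1))
    ≡⟨ lucas-skip (2 N.* j N.+ 1) ⟩
  + 3 * + lucas (2 N.+ (2 N.* j N.+ 1)) - oddLucas j
    ≡⟨ cong (λ i → + 3 * + lucas i - oddLucas j) (sym (2*suc+1 j)) ⟩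
  + 3 * oddLucas (suc j) - oddLucas j ∎

W-leading-step : ∀ j → Leading j (oddLucas j) (W j) → Leading (suc j) (oddLucas (suc j)) (W (suc j)) →
                 Leading (suc (suc j)) (oddLucas (suc (suc j))) (W (suc (suc j)))
W-leading-step j lead₀@(leading low₀) lead₁@(leading low₁) = leading (degreeBelow-cong split
  (degreeBelow-- (degreeBelow-+ (degreeBelow-* (+ 3) (degreeBelow-x low₁))
                                (degreeBelow-* (+ 2) (leading⇒degreeBelow lead₁)))
                 (degreeBelow-+ (degreeBelow-x (degreeBelow-x low₀))
                                (degreeBelow-+ (degreeBelow-* (+ 2) (degreeBelow-x (leading⇒degreeBelow lead₀)))
                                               (degreeBelow-suc (leading⇒degreeBelow lead₀))))))
  where
  identity : ∀ s w₁ w₀ L₁ L₀ p →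
    + 3 * (s * (w₁ - L₁ * (s * p))) + + 2 * w₁ - (s * (s * (w₀ - L₀ * p)) + (+ 2 * (s * w₀) + w₀))
      ≡ (+ 3 * s + + 2) * w₁ - (s + + 1) * (s + + 1) * w₀ - (+ 3 * L₁ - L₀) * (s * (s * p))
  identity = solve-∀
  split : ∀ s → _ ≡ W (suc (suc j)) s - oddLucas (suc (suc j)) * s ^ suc (suc j)
  split s = trans (identity s (W (suc j) s) (W j s) (oddLucas (suc j)) (oddLucas j) (s ^ j))
                  (cong (λ L → W (suc (suc j)) s - L * s ^ suc (suc j)) (sym (oddLucas-recurrence j)))

W-leading : ∀ j → Leading j (oddLucas j) (W j)
W-leading zero          = leading ([] , λ s → refl)
W-leading (suc zero)    = leading (+ 3 ∷ [] , λ s → constant s)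
  where
  constant : ∀ s → + 4 * s + + 3 - + 4 * (s * + 1) ≡ + 3 + s * + 0
  constant = solve-∀
W-leading (suc (suc j)) = W-leading-step j (W-leading j) (W-leading (suc j))

lucasOddProdBelow : ℕ → ℤ
lucasOddProdBelow zero    = + 1
lucasOddProdBelow (suc m) = lucasOddProd m

-- Induction peels off a W_m, which cancels the top term; the factor L_{2m+1} cleared at each
-- step keeps the remaining coefficients integral.
W-span : ∀ m {a f} → Leading m a f →
         ∃ λ (g : Vec ℤ m) → ∀ s → lucasOddProd m * f s ≡ combine (g ∷ʳ lucasOddProdBelow m * a) (λ j → W j s)
W-span zero    {a} {f} (leading ([] , hf)) = [] , λ s → begin
  + 1 * f s                                   ≡⟨ split (f s) a ⟩
  (f s - a * + 1) + (+ 1 * a * + 1 + + 0)     ≡⟨ cong (_+ (+ 1 * a * + 1 + + 0)) (hf s) ⟩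
  + 0 + (+ 1 * a * + 1 + + 0)                 ≡⟨ ℤ.+-identityˡ _ ⟩
  + 1 * a * + 1 + + 0 ∎
  where
  split : ∀ y a → + 1 * y ≡ (y - a * + 1) + (+ 1 * a * + 1 + + 0)
  split = solve-∀
W-span (suc m) {a} {f} lf =
  let b , lh    = degreeBelow⇒leading (degreeBelow-- (degreeBelow-* L (lowerTerms lf))
                                                    (degreeBelow-* a (lowerTerms (W-leading (suc m)))))
      g , span  = W-span m lh
  in  g ∷ʳ lucasOddProdBelow m * b , λ s → begin
  P * L * f s
    ≡⟨ split P L a (f s) (W (suc m) s) (s ^ suc m) ⟩
  P * h s + P * a * W (suc m) s
    ≡⟨ cong (_+ P * a * W (suc m) s) (span s) ⟩
  combine (g ∷ʳ lucasOddProdBelow m * b) (λ j → W j s) + P * a * W (suc m) s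
    ≡⟨ sym (combine-∷ʳ (g ∷ʳ _) (P * a) (λ j → W j s)) ⟩
  combine (g ∷ʳ lucasOddProdBelow m * b ∷ʳ P * a) (λ j → W j s) ∎
  where
  P = lucasOddProd m
  L = oddLucas (suc m)
  h : ℤ → ℤ
  h s = L * (f s - a * s ^ suc m) - a * (W (suc m) s - L * s ^ suc m)
  split : ∀ P L a y w p → P * L * y ≡ P * (L * (y - a * p) - a * (w - L * p)) + P * a * w
  split = solve-∀

oddFib : ℕ → ℤ
oddFib n = + fib (2 N.* n N.+ 1)

evenFib : ℕ → ℤ
evenFib n = + fib (2 N.* n)

oddFib-suc : ∀ n → oddFib (suc n) ≡ oddFib n + evenFib (suc n)
oddFib-suc n = begin
  + fib (2 N.* suc n N.+ 1)                 ≡⟨ cong (+_ ∘ fib) (2*suc+1 n) ⟩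
  + fib (suc (2 N.* n N.+ 1)) + oddFib n    ≡⟨ cong (λ i → + fib i + oddFib n) (sym (2*suc n)) ⟩
  evenFib (suc n) + oddFib n                ≡⟨ ℤ.+-comm (evenFib (suc n)) (oddFib n) ⟩
  oddFib n + evenFib (suc n) ∎

cassiniDefect : ℕ → ℤ
cassiniDefect k = + fib (2 N.+ k) * + fib k - + fib (suc k) * + fib (suc k)

cassiniDefect-suc : ∀ k → cassiniDefect (suc k) ≡ - cassiniDefect k
cassiniDefect-suc k = identity (+ fib (suc k)) (+ fib k)
  where
  identity : ∀ a b → (a + b + a) * a - (a + b) * (a + b) ≡ - ((a + b) * b - a * a)
  identity = solve-∀

cassiniDefect-odd : ∀ n → cassiniDefect (2 N.* n N.+ 1) ≡ + 1
cassiniDefect-odd zero    = refl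
cassiniDefect-odd (suc n) = begin
  cassiniDefect (2 N.* suc n N.+ 1)          ≡⟨ cong cassiniDefect (2*suc+1 n) ⟩
  cassiniDefect (2 N.+ (2 N.* n N.+ 1))      ≡⟨ cassiniDefect-suc (suc (2 N.* n N.+ 1)) ⟩
  - cassiniDefect (suc (2 N.* n N.+ 1))      ≡⟨ cong -_ (cassiniDefect-suc (2 N.* n N.+ 1)) ⟩
  - - cassiniDefect (2 N.* n N.+ 1)          ≡⟨ ℤ.neg-involutive _ ⟩
  cassiniDefect (2 N.* n N.+ 1)              ≡⟨ cassiniDefect-odd n ⟩
  + 1 ∎

oddFib-cassini : ∀ n → oddFib (suc n) * oddFib n ≡ evenFib (suc n) * evenFib (suc n) + + 1
oddFib-cassini n = begin
  oddFib (suc n) * oddFib n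
    ≡⟨ cong (λ i → + fib i * oddFib n) (2*suc+1 n) ⟩
  + fib (2 N.+ k) * + fib k
    ≡⟨ split (+ fib (2 N.+ k) * + fib k) (+ fib (suc k) * + fib (suc k)) ⟩
  + fib (suc k) * + fib (suc k) + cassiniDefect k
    ≡⟨ cong₂ (λ i d → + fib i * + fib i + d) (sym (2*suc n)) (cassiniDefect-odd n) ⟩
  evenFib (suc n) * evenFib (suc n) + + 1 ∎
  where
  k = 2 N.* n N.+ 1
  split : ∀ a b → a ≡ b + (a - b)
  split = solve-∀

oddPoly : ∀ {k} → Vec ℤ k → ℤ → ℤ
oddPoly g x = combine g (λ j → oddPow j x)

pow-oddPow : ∀ y m → y ^ (2 N.* m N.+ 1) ≡ oddPow m y
pow-oddPow y zero    = refl
pow-oddPow y (suc m) = begin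
  y ^ (2 N.* suc m N.+ 1)     ≡⟨ cong (y ^_) (2*suc+1 m) ⟩
  y * (y * y ^ (2 N.* m N.+ 1)) ≡⟨ cong (λ t → y * (y * t)) (pow-oddPow y m) ⟩
  y * (y * (y * (y * y) ^ m))   ≡⟨ assoc y ((y * y) ^ m) ⟩
  y * (y * y * (y * y) ^ m) ∎
  where
  assoc : ∀ y p → y * (y * (y * p)) ≡ y * (y * y * p)
  assoc = solve-∀

sumFibEvenPow-telescope : ∀ {k} m c (g : Vec ℤ k) → (∀ s → c * s ^ m ≡ combine g (λ j → W j s)) →
                          ∀ n → c * sumFibEvenPow (2 N.* m N.+ 1) n ≡ oddPoly g (oddFib n) - oddPoly g (+ 1)
sumFibEvenPow-telescope m c g span zero    = trans (ℤ.*-zeroʳ c) (sym (ℤ.+-inverseʳ (oddPoly g (+ 1))))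
sumFibEvenPow-telescope m c g span (suc n) = begin
  c * (sumFibEvenPow (2 N.* m N.+ 1) n + y ^ (2 N.* m N.+ 1))
    ≡⟨ ℤ.*-distribˡ-+ c _ _ ⟩
  c * sumFibEvenPow (2 N.* m N.+ 1) n + c * y ^ (2 N.* m N.+ 1)
    ≡⟨ cong₂ _+_ (sumFibEvenPow-telescope m c g span n) term ⟩
  (G (oddFib n) - G (+ 1)) + (G (oddFib (suc n)) - G (oddFib n))
    ≡⟨ cancel (G (oddFib n)) (G (+ 1)) (G (oddFib (suc n))) ⟩
  G (oddFib (suc n)) - G (+ 1) ∎
  where
  G = oddPoly g
  y = evenFib (suc n)
  cancel : ∀ a b c → (a - b) + (c - a) ≡ c - b
  cancel = solve-∀
  swap : ∀ c y p → c * (y * p) ≡ y * (c * p)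
  swap = solve-∀
  term : c * y ^ (2 N.* m N.+ 1) ≡ G (oddFib (suc n)) - G (oddFib n)
  term = begin
    c * y ^ (2 N.* m N.+ 1)                            ≡⟨ cong (c *_) (pow-oddPow y m) ⟩
    c * (y * (y * y) ^ m)                              ≡⟨ swap c y _ ⟩
    y * (c * (y * y) ^ m)                              ≡⟨ cong (y *_) (span (y * y)) ⟩
    y * combine g (λ j → W j (y * y))                  ≡⟨ sym (combine-*ˡ g y _) ⟩
    combine g (λ j → y * W j (y * y))
      ≡⟨ combine-cong g (oddPow-sub-W {oddFib (suc n)} {oddFib n} {y} (oddFib-suc n) (oddFib-cassini n)) ⟩
    combine g (λ j → oddPow j (oddFib (suc n)) - oddPow j (oddFib n))
      ≡⟨ combine-- g _ _ ⟩
    G (oddFib (suc n)) - G (oddFib n) ∎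

quotSq : ℕ → ℤ → ℤ
quotSq zero    x = + 0
quotSq (suc k) x = + suc k + x * quotSq k x

quotSq-spec : ∀ k x → (x - + 1) * (x - + 1) * quotSq k x ≡ x ^ suc k - + 1 - + suc k * (x - + 1)
quotSq-spec zero    x = base x
  where
  base : ∀ x → (x - + 1) * (x - + 1) * + 0 ≡ x * + 1 - + 1 - + 1 * (x - + 1)
  base = solve-∀
quotSq-spec (suc k) x = begin
  (x - + 1) * (x - + 1) * (c + x * quotSq k x)
    ≡⟨ distrib x c (quotSq k x) ⟩
  (x - + 1) * (x - + 1) * c + x * ((x - + 1) * (x - + 1) * quotSq k x)
    ≡⟨ cong (λ t → (x - + 1) * (x - + 1) * c + x * t) (quotSq-spec k x) ⟩
  (x - + 1) * (x - + 1) * c + x * (x ^ suc k - + 1 - c * (x - + 1))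
    ≡⟨ collect x c (x ^ suc k) ⟩
  x * x ^ suc k - + 1 - (+ 1 + c) * (x - + 1) ∎
  where
  c = + suc k
  distrib : ∀ x c q → (x - + 1) * (x - + 1) * (c + x * q)
                      ≡ (x - + 1) * (x - + 1) * c + x * ((x - + 1) * (x - + 1) * q)
  distrib = solve-∀
  collect : ∀ x c p → (x - + 1) * (x - + 1) * c + x * (p - + 1 - c * (x - + 1))
                      ≡ x * p - + 1 - (+ 1 + c) * (x - + 1)
  collect = solve-∀

quotSq-leading : ∀ k → Leading k (+ 1) (quotSq (suc k))
quotSq-leading zero    = leading ([] , constant)
  where
  constant : ∀ x → + 1 + x * + 0 - + 1 * + 1 ≡ + 0
  constant = solve-∀
quotSq-leading (suc k) =
  leading (degreeBelow-cong shift (degreeBelow-horner (+ suc (suc k)) (lowerTerms (quotSq-leading k))))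
  where
  shift : ∀ x → + suc (suc k) + x * (quotSq (suc k) x - + 1 * x ^ k)
                ≡ quotSq (suc (suc k)) x - + 1 * x ^ suc k
  shift x = identity (+ suc (suc k)) x (quotSq (suc k) x) (x ^ k)
    where
    identity : ∀ c x q p → c + x * (q - + 1 * p) ≡ c + x * q - + 1 * (x * p)
    identity = solve-∀

quotSq-degreeBelow : ∀ k → DegreeBelow k (quotSq k)
quotSq-degreeBelow zero    = [] , λ _ → refl
quotSq-degreeBelow (suc k) = leading⇒degreeBelow (quotSq-leading k)

oddPow-one : ∀ j → oddPow j (+ 1) ≡ + 1
oddPow-one j = trans (ℤ.*-identityˡ _) (ℤ.^-zeroˡ j)

-- combine g W₀ = Σ_j (2j+1) g_j is G′(1).
oddPoly-factor : ∀ {k} (g : Vec ℤ k) → combine g (λ j → W j (+ 0)) ≡ + 0 → ∀ x →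
                 oddPoly g x - oddPoly g (+ 1) ≡ (x - + 1) ^ 2 * combine g (λ j → quotSq (2 N.* j) x)
oddPoly-factor g vanishes x = begin
  G x - G (+ 1)
    ≡⟨ drop (G x - G (+ 1)) (x - + 1) ⟩
  G x - G (+ 1) - (x - + 1) * + 0
    ≡⟨ cong (λ t → G x - G (+ 1) - (x - + 1) * t) (sym vanishes) ⟩
  G x - G (+ 1) - (x - + 1) * combine g W₀
    ≡⟨ cong₂ _-_ (sym (combine-- g (λ j → oddPow j x) (λ j → oddPow j (+ 1))))
                 (sym (combine-*ˡ g (x - + 1) W₀)) ⟩
  combine g (λ j → oddPow j x - oddPow j (+ 1)) - combine g (λ j → (x - + 1) * W₀ j)
    ≡⟨ sym (combine-- g _ _) ⟩
  combine g (λ j → oddPow j x - oddPow j (+ 1) - (x - + 1) * W₀ j)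
    ≡⟨ combine-cong g (λ j → sym (term j)) ⟩
  combine g (λ j → (x - + 1) ^ 2 * Q j)
    ≡⟨ combine-*ˡ g ((x - + 1) ^ 2) Q ⟩
  (x - + 1) ^ 2 * combine g Q ∎
  where
  G = oddPoly g
  W₀ = λ j → W j (+ 0)
  Q = λ j → quotSq (2 N.* j) x
  drop : ∀ a b → a ≡ a - b * + 0
  drop = solve-∀
  square : ∀ y q → y ^ 2 * q ≡ y * y * q
  square y q = cong (λ t → y * t * q) (ℤ.*-identityʳ y)
  term : ∀ j → (x - + 1) ^ 2 * Q j ≡ oddPow j x - oddPow j (+ 1) - (x - + 1) * W₀ j
  term j = begin
    (x - + 1) ^ 2 * Q j
      ≡⟨ square (x - + 1) _ ⟩
    (x - + 1) * (x - + 1) * quotSq (2 N.* j) x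
      ≡⟨ quotSq-spec (2 N.* j) x ⟩
    x ^ suc (2 N.* j) - + 1 - + suc (2 N.* j) * (x - + 1)
      ≡⟨ cong₂ (λ p w → p - + 1 - w * (x - + 1)) x^[2j+1] (sym (W-at-zero j)) ⟩
    oddPow j x - + 1 - W₀ j * (x - + 1)
      ≡⟨ cong₂ (λ o t → oddPow j x - o - t) (sym (oddPow-one j)) (ℤ.*-comm (W₀ j) (x - + 1)) ⟩
    oddPow j x - oddPow j (+ 1) - (x - + 1) * W₀ j ∎
    where
    x^[2j+1] : x ^ suc (2 N.* j) ≡ oddPow j x
    x^[2j+1] = trans (cong (x ^_) (ℕ.+-comm 1 (2 N.* j))) (pow-oddPow x j)

quotSqCombine-leading : ∀ {m} (g : Vec ℤ (suc m)) c →
                        Leading (2 N.* suc m ∸ 1) c (λ x → combine (g ∷ʳ c) (λ j → quotSq (2 N.* j) x))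
quotSqCombine-leading {m} g c = leading (degreeBelow-cong split
  (degreeBelow-+ (degreeBelow-combine (λ j → quotSq (2 N.* j)) lower g)
                 (degreeBelow-* c (lowerTerms (quotSq-leading d)))))
  where
  d = 2 N.* suc m ∸ 1
  lower : ∀ j → j N.< suc m → DegreeBelow d (quotSq (2 N.* j))
  lower j j<m = degreeBelow-mono (ℕ.≤⇒≤′ (ℕ.<⇒≤pred (ℕ.*-monoʳ-< 2 j<m))) (quotSq-degreeBelow (2 N.* j))
  split : ∀ x → combine g (λ j → quotSq (2 N.* j) x) + c * (quotSq (2 N.* suc m) x - + 1 * x ^ d)
                ≡ combine (g ∷ʳ c) (λ j → quotSq (2 N.* j) x) - c * x ^ d
  split x = begin
    combine g Q + c * (quotSq (2 N.* suc m) x - + 1 * x ^ d) ≡⟨ regroup (combine g Q) c _ (x ^ d) ⟩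
    combine g Q + c * quotSq (2 N.* suc m) x - c * x ^ d      ≡⟨ cong (_- c * x ^ d) (sym (combine-∷ʳ g c Q)) ⟩
    combine (g ∷ʳ c) Q - c * x ^ d ∎
    where
    Q = λ j → quotSq (2 N.* j) x
    regroup : ∀ s c q p → s + c * (q - + 1 * p) ≡ s + c * q - c * p
    regroup = solve-∀

lucas-suc : ∀ n → ∃ λ k → lucas n ≡ suc k
lucas-suc zero          = 1 , refl
lucas-suc (suc zero)    = 0 , refl
lucas-suc (suc (suc n)) = let k , eq = lucas-suc (suc n) in k N.+ lucas n , cong (N._+ lucas n) eq

lucasOddProd-suc : ∀ m → ∃ λ k → lucasOddProd m ≡ + suc k
lucasOddProd-suc zero    = 0 , refl
lucasOddProd-suc (suc m) =
  let _ , eq = lucasOddProd-suc m ; _ , eq′ = lucas-suc (2 N.* suc m N.+ 1)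
  in  _ , cong₂ (λ a b → a * + b) eq eq′

lucasOddProd-nonzero : ∀ m → ¬ (lucasOddProd m ≡ + 0)
lucasOddProd-nonzero m eq = case trans (sym (proj₂ (lucasOddProd-suc m))) eq of λ ()

mainTheorem1 : (m : ℕ) → 1 N.≤ m →
    Σ Poly λ P → HasDegree P (2 N.* m ∸ 1) ×
      ((n : ℕ) → 1 N.≤ n →
        lucasOddProd m * sumFibEvenPow (2 N.* m N.+ 1) n
          ≡ ((+ fib (2 N.* n N.+ 1) - + 1) ^ 2) * eval P (+ fib (2 N.* n N.+ 1)))
mainTheorem1 (suc m) _ =
  let g , span           = W-span (suc m) (leading-monomial (suc m))
      G                  = g ∷ʳ c
      P , degree , evalP = leading⇒hasDegree (quotSqCombine-leading g c) c≢0
      W-vanishes : combine G (λ j → W j (+ 0)) ≡ + 0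
      W-vanishes = trans (sym (span (+ 0))) (ℤ.*-zeroʳ (lucasOddProd (suc m)))
  in  P , degree , λ n _ → begin
  lucasOddProd (suc m) * sumFibEvenPow (2 N.* suc m N.+ 1) n
    ≡⟨ sumFibEvenPow-telescope (suc m) (lucasOddProd (suc m)) G span n ⟩
  oddPoly G (oddFib n) - oddPoly G (+ 1)
    ≡⟨ oddPoly-factor G W-vanishes (oddFib n) ⟩
  (oddFib n - + 1) ^ 2 * combine G (λ j → quotSq (2 N.* j) (oddFib n))
    ≡⟨ cong ((oddFib n - + 1) ^ 2 *_) (sym (evalP (oddFib n))) ⟩
  (oddFib n - + 1) ^ 2 * eval P (oddFib n) ∎
  where
  c = lucasOddProdBelow (suc m) * + 1
  c≢0 : ¬ (c ≡ + 0)
  c≢0 = lucasOddProd-nonzero m ∘ trans (sym (ℤ.*-identityʳ (lucasOddProd m)))
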